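{- Let $H$ be a maximal plane graph and $f$ a face of $H$ whose boundary vertices are labelled $x,y,z$, and let $k$ be an integer. Then at most one of the sets $(k)_{x,y}^{z}$ and $(k+1)_{x,y}^{z}$ is nonempty. Similarly, at most one of the sets $(k)_{x}^{y,z}$ and $(k+1)_{x}^{y,z}$ is nonempty.
   Context: $H$ is a maximal plane graph (every face bounded by a triangle); $d$ is shortest-path distance in $H$. $\mathrm{qcc}_H(S)=\{u\in V(H): \forall v\in V(H)\ \exists s\in S \text{ with } d(u,s)\geq d(v,s)\}$, and $Q:=\mathrm{qcc}_H(\{x,y,z\})$. For an integer $k$ and disjoint $A,B\subseteq\{x,y,z\}$, $(k)_A^B$ denotes the set of $u\in Q$ with $\min_{t\in\{x,y,z\}}d(u,t)=k$, $d(u,t)=k$ for all $t\in A$ and $d(u,t)=k+1$ for all $t\in B$ (subscripts/superscripts written as lists, e.g. $(k)_{x,y}^z$: $d(u,x)=d(u,y)=k$, $d(u,z)=k+1$). -}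

module Defs where

open import Data.Nat using (ℕ; zero; suc; _+_; _*_; _≤_)
open import Data.Fin using (Fin)
open import Data.Product using (Σ; ∃; ∃-syntax; _×_; _,_)
open import Data.Sum using (_⊎_)
open import Relation.Binary.PropositionalEquality using (_≡_; _≢_)

iter : {A : Set} → (A → A) → ℕ → A → A
iter f zero    a = a
iter f (suc k) a = f (iter f k a)

-- A combinatorial map (rotation system) with vertex set Fin n and D darts:
--   * tail d : the vertex at which dart d starts,
--   * α  : the involution pairing the two darts (half-edges) of an edge,
--   * σ  : the rotation (cyclic order of darts around each vertex),
--   * φ = σ ∘ α : the face permutation; its orbits are the faces, and the
--     boundary walk of the face of d visits tail d, tail (φ d), tail (φ (φ d)), ...
record CombMap (n : ℕ) : Set where
  field
    D    : ℕ
    tail : Fin D → Fin n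
    α    : Fin D → Fin D
    σ    : Fin D → Fin D

module _ {n : ℕ} (M : CombMap n) where
  open CombMap M

  φ : Fin D → Fin D
  φ d = σ (α d)

  Adj : Fin n → Fin n → Set
  Adj u v = ∃[ d ] (tail d ≡ u × tail (α d) ≡ v)

  data Walk : Fin n → Fin n → ℕ → Set where
    [] : ∀ {u} → Walk u u 0
    _∷_ : ∀ {u v w ℓ} → Adj u v → Walk v w ℓ → Walk u w (suc ℓ)

  Dist : Fin n → Fin n → ℕ → Set
  Dist u v k = Walk u v k × (∀ m → Walk u v m → k ≤ m)

  OnFace : Fin D → Fin n → Set
  OnFace d v = (v ≡ tail d) ⊎ ((v ≡ tail (φ d)) ⊎ (v ≡ tail (φ (φ d))))

  IsFace : Fin n → Fin n → Fin n → Set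
  IsFace x y z = (∃[ d ] (OnFace d x × OnFace d y × OnFace d z))
                 × x ≢ y × y ≢ z × x ≢ z

  DistGeq : Fin n → Fin n → Fin n → Set
  DistGeq u v s = ∀ a b → Dist u s a → Dist v s b → b ≤ a

  InQcc : Fin n → Fin n → Fin n → Fin n → Set
  InQcc x y z u = ∀ v → DistGeq u v x ⊎ (DistGeq u v y ⊎ DistGeq u v z)

  -- u ∈ (k)_{x,y}^{z}   (min_t d(u,t) = k is implied by the other conditions)
  In-k-xy-z : Fin n → Fin n → Fin n → ℕ → Fin n → Set
  In-k-xy-z x y z k u = InQcc x y z u × Dist u x k × Dist u y k × Dist u z (suc k)

  -- u ∈ (k)_{x}^{y,z}   (min_t d(u,t) = k is implied by the other conditions)
  In-k-x-yz : Fin n → Fin n → Fin n → ℕ → Fin n → Set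
  In-k-x-yz x y z k u = InQcc x y z u × Dist u x k × Dist u y (suc k) × Dist u z (suc k)

  -- The map is a maximal plane graph:
  --   * α fixed-point-free involution, σ a permutation whose orbits are exactly
  --     the fibres of tail (so vertices = σ-orbits), every vertex has a dart;
  --   * simple: no loops, no parallel edges;
  --   * every face is a triangle: φ³ = id and φ has no fixed point;
  --   * connected, and of genus 0: Euler's formula V - E + F = 2 with
  --     V = n, E = D/2, F = D/3 (all faces triangles), i.e. 6n = D + 12.
  record IsMaximalPlane : Set where
    field
      σ⁻¹       : Fin D → Fin D
      α-invol   : ∀ d → α (α d) ≡ d
      α-nofix   : ∀ d → α d ≢ d
      σ-inv₁    : ∀ d → σ (σ⁻¹ d) ≡ d
      σ-inv₂    : ∀ d → σ⁻¹ (σ d) ≡ d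
      σ-tail    : ∀ d → tail (σ d) ≡ tail d
      σ-trans   : ∀ d d′ → tail d ≡ tail d′ → ∃[ k ] iter σ k d ≡ d′
      tail-surj : ∀ v → ∃[ d ] tail d ≡ v
      no-loop   : ∀ d → tail (α d) ≢ tail d
      no-multi  : ∀ d d′ → tail d ≡ tail d′ → tail (α d) ≡ tail (α d′) → d ≡ d′
      face-tri  : ∀ d → φ (φ (φ d)) ≡ d
      face-nontriv : ∀ d → φ d ≢ d
      connected : ∀ u v → ∃[ ℓ ] Walk u v ℓ
      euler     : 6 * n ≡ D + 12

{-# OPTIONS --safe #-}
module Submission where

-- A vertex u of qcc_H(S) is, for every vertex w, at least as far as w from some s ∈ S.
-- Every vertex of (k+1)_A^B is one step farther than every vertex of (k)_A^B from each
-- of x, y, z, so the two sets cannot both be inhabited.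

open import Defs
open import Data.Nat using (ℕ; suc; _<_)
open import Data.Nat.Properties using (<⇒≱; n<1+n)
open import Data.Fin using (Fin)
open import Data.Product using (∃-syntax; _×_; _,_)
open import Data.Sum using (inj₁; inj₂)
open import Data.Empty using (⊥)
open import Relation.Nullary using (¬_)

module _ {n : ℕ} (M : CombMap n) where

  ¬DistGeq-of-< : ∀ {u v s a b} → Dist M u s a → Dist M v s b → a < b →
                  ¬ DistGeq M u v s
  ¬DistGeq-of-< du dv a<b geq = <⇒≱ a<b (geq _ _ du dv)

  InQcc-¬strictlyCloser : ∀ {x y z u w a b c a′ b′ c′} → InQcc M x y z u →
    Dist M u x a → Dist M u y b → Dist M u z c →
    Dist M w x a′ → Dist M w y b′ → Dist M w z c′ →
    a < a′ → b < b′ → c < c′ → ⊥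
  InQcc-¬strictlyCloser q ux uy uz wx wy wz a<a′ b<b′ c<c′ with q _
  ... | inj₁ geq        = ¬DistGeq-of-< ux wx a<a′ geq
  ... | inj₂ (inj₁ geq) = ¬DistGeq-of-< uy wy b<b′ geq
  ... | inj₂ (inj₂ geq) = ¬DistGeq-of-< uz wz c<c′ geq

lemma12 : ∀ {n} (H : CombMap n) → IsMaximalPlane H →
    (x y z : Fin n) → IsFace H x y z → (k : ℕ) →
    ¬ ((∃[ u ] In-k-xy-z H x y z k u) × (∃[ u ] In-k-xy-z H x y z (suc k) u))
    × ¬ ((∃[ u ] In-k-x-yz H x y z k u) × (∃[ u ] In-k-x-yz H x y z (suc k) u))
lemma12 H _ x y z _ k = xy-z-exclusive , x-yz-exclusive
  where
  xy-z-exclusive : ¬ ((∃[ u ] In-k-xy-z H x y z k u) × (∃[ u ] In-k-xy-z H x y z (suc k) u))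
  xy-z-exclusive ((u , q , ux , uy , uz) , (w , _ , wx , wy , wz)) =
    InQcc-¬strictlyCloser H q ux uy uz wx wy wz (n<1+n k) (n<1+n k) (n<1+n (suc k))

  x-yz-exclusive : ¬ ((∃[ u ] In-k-x-yz H x y z k u) × (∃[ u ] In-k-x-yz H x y z (suc k) u))
  x-yz-exclusive ((u , q , ux , uy , uz) , (w , _ , wx , wy , wz)) =
    InQcc-¬strictlyCloser H q ux uy uz wx wy wz (n<1+n k) (n<1+n (suc k)) (n<1+n (suc k))
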